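{- Let $G$ be a connected graph of order $n \ge 3$ with diameter at most $2$. Then $\gamma_{\rm it}^{\rm g}(G) \le \frac{2}{3}n$ and $\gamma_{\rm it}^{\rm g\prime}(G) \le \frac{2}{3}n$.
   Context: All graphs are finite and simple. For a vertex set $S$, $N_G(S)$ denotes the set of vertices adjacent to at least one vertex of $S$, and $G - X$ is the graph obtained by deleting the vertices of $X$. The total isolation game on a graph $G$ is played by two players, Dominator and Staller, who alternately select vertices of $G$. If $S$ is the set of vertices selected so far, a vertex $v$ may be selected only if $v$ is adjacent to some vertex $u$ such that either $u$ belongs to a component of $G - N_G(S)$ of order at least $2$, or $u \in S$ and $u$ is an isolated vertex of $G - N_G(S)$. The game ends when no such vertex exists. Dominator aims to minimize the total number of selected vertices, Staller aims to maximize it. $\gamma_{\rm it}^{\rm g}(G)$ (resp. $\gamma_{\rm it}^{\rm g\prime}(G)$) is the number of moves in the game in which Dominator (resp. Staller) makes the first move and both players play optimally. -}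

module Defs where

open import Data.Nat using (ℕ; zero; suc; _⊓_; _⊔_)
open import Data.Bool using (Bool; true; false; _∧_; _∨_; not; if_then_else_; T)
open import Data.Fin using (Fin; _≟_)
open import Data.List using (List; []; _∷_; filter; map; foldr)
open import Data.Bool.ListAction using (any)
open import Data.List using (allFin)
open import Data.Product using (∃; _×_)
open import Data.Sum using (_⊎_)
open import Relation.Binary.PropositionalEquality using (_≡_)
open import Relation.Nullary using (¬_; does)
open import Relation.Nullary.Decidable using (⌊_⌋)

record Graph (n : ℕ) : Set where
  field
    adj    : Fin n → Fin n → Bool
    sym    : ∀ u v → adj u v ≡ adj v u
    irrefl : ∀ v → adj v v ≡ false
open Graph public

Adj : ∀ {n} → Graph n → Fin n → Fin n → Set
Adj G u v = T (adj G u v)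

data Walk {n : ℕ} (G : Graph n) : Fin n → Fin n → Set where
  here : ∀ {u} → Walk G u u
  step : ∀ {u v w} → Adj G u v → Walk G v w → Walk G u w

Connected : ∀ {n} → Graph n → Set
Connected G = ∀ u v → Walk G u v

DiamAtMost2 : ∀ {n} → Graph n → Set
DiamAtMost2 G = ∀ u v → ¬ (u ≡ v) → Adj G u v ⊎ ∃ λ w → Adj G u w × Adj G w v

VSet : ℕ → Set
VSet n = Fin n → Bool

insert : ∀ {n} → Fin n → VSet n → VSet n
insert v S x = ⌊ x ≟ v ⌋ ∨ S x

∅ : ∀ {n} → VSet n
∅ _ = false

module Game {n : ℕ} (G : Graph n) where

  inN : VSet n → Fin n → Bool
  inN S x = any (λ w → S w ∧ adj G w x) (allFin n)

  -- u lies in a component of order ≥ 2 of G - N_G(S):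
  -- u ∉ N_G(S) and u has a neighbour w ∉ N_G(S) (in the induced subgraph).
  inBigComp : VSet n → Fin n → Bool
  inBigComp S u = not (inN S u) ∧ any (λ w → adj G u w ∧ not (inN S w)) (allFin n)

  -- u ∈ S and u is an isolated vertex of G - N_G(S).
  isolatedSelected : VSet n → Fin n → Bool
  isolatedSelected S u = S u ∧ not (inN S u) ∧ not (any (λ w → adj G u w ∧ not (inN S w)) (allFin n))

  legal : VSet n → Fin n → Bool
  legal S v = not (S v) ∧ any (λ u → adj G v u ∧ (inBigComp S u ∨ isolatedSelected S u)) (allFin n)

  moves : VSet n → List (Fin n)
  moves S = filter (λ v → T? (legal S v)) (allFin n)
    where
    open import Data.Bool.Properties using (T?)

  data Player : Set where
    dominator staller : Player

  other : Player → Player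
  other dominator = staller
  other staller   = dominator

  opt : Player → ℕ → List ℕ → ℕ
  opt dominator x xs = foldr _⊓_ x xs
  opt staller   x xs = foldr _⊔_ x xs

  -- Fuel bounds the game length; since each move selects a new
  -- vertex, fuel n suffices from the empty position.
  value : ℕ → Player → VSet n → ℕ
  value zero    p S = zero
  value (suc k) p S with moves S
  ... | []     = zero
  ... | v ∷ vs = suc (opt p (value k (other p) (insert v S))
                            (map (λ w → value k (other p) (insert w S)) vs))

γitg : ∀ {n} → Graph n → ℕ
γitg {n} G = Game.value G n Game.dominator ∅

γitg′ : ∀ {n} → Graph n → ℕ
γitg′ {n} G = Game.value G n Game.staller ∅

-- Call a vertex a target if a move next to it is legal: it is undominated and either lies in a
-- component of order at least 2 of G − N(S) or is selected and isolated there.  Every move removes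
-- a target, and while two targets remain Dominator can remove two at once: diameter 2 provides a
-- common neighbour of two targets, or a vertex that dominates one end of an isolated edge of
-- G − N(S) and isolates the other.  With t targets left this gives 3·(moves still to come) ≤ 2t + 1
-- when Dominator is to move and ≤ 2t + 2 when Staller is.  From t ≤ n the bound 2n/3 follows
-- once the first move removes enough targets: Dominator can remove three unless n ∈ {3, 5}, where
-- 3 ∤ 2n + 1 turns the bound 2n + 1 into 2n; a first Staller move removes two unless it is a leaf,
-- whose neighbour then dominates the whole graph and ends the game.

module Submission where

open import Defs hiding (sym)
open import Data.Nat using (ℕ; zero; suc; _≤_; _<_; _*_; _+_; _⊓_; z≤n; s≤s)
open import Data.Nat.Divisibility using (_∣_; _∣?_; m∣m*n)
open import Data.Nat.Tactic.RingSolver using (solve-∀)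
open import Data.Nat.Properties
  using (≤-refl; ≤-trans; ≤-reflexive; n≤1+n; m≤n+m; +-suc; +-identityʳ; +-monoˡ-≤; +-monoʳ-≤;
         module ≤-Reasoning; +-mono-≤; +-mono-<-≤; +-mono-≤-<; ≤-pred;
         *-suc; *-monoʳ-≤; n≤0⇒n≡0; m≤n⇒m⊓o≤n; m≤n⇒o⊓m≤n; ≤∧≢⇒<; ⊓-sel; ⊔-sel; _≤?_; ≰⇒>;
         m+n≤o⇒m≤o)
open import Data.Bool using (Bool; true; false; T; not; _∧_; _∨_)
open import Data.Bool.Properties using (T?; T-∧)
open import Data.Bool.ListAction using (any)
open import Data.Fin using (Fin; _≟_; fromℕ<) renaming (zero to fzero; suc to fsuc)
open import Data.Fin.Properties using (suc-injective; any?)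
open import Data.List using (List; []; _∷_; length; foldr; map; allFin)
open import Data.List.Properties using (foldr-preservesᵇ; foldr-preservesᵒ)
open import Data.List.Membership.Propositional using (_∈_; lose)
open import Data.List.Membership.Propositional.Properties
  using (∈-allFin; ∈-map⁺; ∈-map⁻; ∈-filter⁺; ∈-filter⁻)
open import Data.List.Relation.Unary.Any.Properties using (any⁺; any⁻)
open import Data.List.Relation.Unary.Any using (Any; here; there; satisfied)
import Data.List.Relation.Unary.Any as Any
open import Algebra.Definitions using (Selective)
open import Data.List.Relation.Unary.All using (All; []; _∷_)
import Data.List.Relation.Unary.All as All
open import Data.List.Relation.Unary.Unique.Propositional using (Unique; []; _∷_)
open import Data.Product using (∃; ∃₂; _×_; _,_; proj₁; proj₂; map₂; uncurry)
open import Data.Sum using (_⊎_; inj₁; inj₂; [_,_]′)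
open import Data.Unit using (tt)
open import Data.Empty using (⊥; ⊥-elim)
open import Function using (_∘_)
open import Function.Bundles using (module Equivalence)
open import Relation.Nullary using (¬_; Dec; yes; no)
open import Relation.Nullary.Decidable using (_×-dec_; ¬?; decidable-stable; from-no)
open import Relation.Unary using (Decidable)
open import Relation.Binary.PropositionalEquality using (_≡_; _≢_; refl; sym; cong; subst)

bit : Bool → ℕ
bit true  = 1
bit false = 0

∣_∣ : ∀ {n} → VSet n → ℕ
∣_∣ {zero}  S = 0
∣_∣ {suc n} S = bit (S fzero) + ∣ S ∘ fsuc ∣

infix 4 _⊆_

_⊆_ : ∀ {n} → VSet n → VSet n → Set
S ⊆ S′ = ∀ x → T (S x) → T (S′ x)

bit-mono : ∀ {a b} → (T a → T b) → bit a ≤ bit b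
bit-mono {false}         _   = z≤n
bit-mono {true}  {true}  _   = ≤-refl
bit-mono {true}  {false} a⇒b = ⊥-elim (a⇒b tt)

bit-mono-< : ∀ {a b} → ¬ T a → T b → bit a < bit b
bit-mono-< {false} {true} _ _ = ≤-refl
bit-mono-< {true}  ¬a _ = ⊥-elim (¬a tt)

bit≤1 : ∀ b → bit b ≤ 1
bit≤1 true  = ≤-refl
bit≤1 false = z≤n

∣∅∣≡0 : ∀ {n} → ∣ ∅ {n} ∣ ≡ 0
∣∅∣≡0 {zero}  = refl
∣∅∣≡0 {suc n} = ∣∅∣≡0 {n}

∣S∣≤n : ∀ {n} (S : VSet n) → ∣ S ∣ ≤ n
∣S∣≤n {zero}  S = z≤n
∣S∣≤n {suc n} S = +-mono-≤ (bit≤1 (S fzero)) (∣S∣≤n (S ∘ fsuc))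

∣∣-mono : ∀ {n} {S S′ : VSet n} → S ⊆ S′ → ∣ S ∣ ≤ ∣ S′ ∣
∣∣-mono {zero}  S⊆S′ = z≤n
∣∣-mono {suc n} S⊆S′ = +-mono-≤ (bit-mono (S⊆S′ fzero)) (∣∣-mono (S⊆S′ ∘ fsuc))

∣∣-mono-< : ∀ {n} {S S′ : VSet n} {x} → S ⊆ S′ → ¬ T (S x) → T (S′ x) → ∣ S ∣ < ∣ S′ ∣
∣∣-mono-< {x = fzero}  S⊆S′ x∉S x∈S′ =
  +-mono-<-≤ (bit-mono-< x∉S x∈S′) (∣∣-mono (S⊆S′ ∘ fsuc))
∣∣-mono-< {x = fsuc x} S⊆S′ x∉S x∈S′ =
  +-mono-≤-< (bit-mono (S⊆S′ fzero)) (∣∣-mono-< {x = x} (S⊆S′ ∘ fsuc) x∉S x∈S′)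

∃-nonmember : ∀ {n} (S : VSet n) → ∣ S ∣ < n → ∃ λ x → ¬ T (S x)
∃-nonmember {suc n} S ∣S∣<n with S fzero in eq
... | false = fzero , subst T eq
... | true  with ∃-nonmember (S ∘ fsuc) (≤-pred ∣S∣<n)
...   | x , x∉S = fsuc x , x∉S

∃-member : ∀ {n} (S : VSet n) → 0 < ∣ S ∣ → ∃ λ x → T (S x)
∃-member {suc n} S 0<∣S∣ with S fzero in eq
... | true  = fzero , subst T (sym eq) tt
... | false with ∃-member (S ∘ fsuc) 0<∣S∣
...   | x , x∈S = fsuc x , x∈S

∃-two-members : ∀ {n} (S : VSet n) → 2 ≤ ∣ S ∣ → ∃₂ λ x y → x ≢ y × T (S x) × T (S y)
∃-two-members {suc n} S 2≤∣S∣ with S fzero in eq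
... | true with ∃-member (S ∘ fsuc) (≤-pred 2≤∣S∣)
...   | y , y∈S = fzero , fsuc y , (λ ()) , subst T (sym eq) tt , y∈S
∃-two-members {suc n} S 2≤∣S∣ | false with ∃-two-members (S ∘ fsuc) 2≤∣S∣
...   | x , y , x≢y , x∈S , y∈S = fsuc x , fsuc y , x≢y ∘ suc-injective , x∈S , y∈S

insert-here : ∀ {n} (x : Fin n) (S : VSet n) → T (insert x S x)
insert-here x S with x ≟ x
... | yes _   = tt
... | no x≢x = ⊥-elim (x≢x refl)

insert-there : ∀ {n} (x : Fin n) {S : VSet n} → S ⊆ insert x S
insert-there x y y∈S with y ≟ x
... | yes _ = tt
... | no _  = y∈S

insert⁻ : ∀ {n} (x : Fin n) (S : VSet n) y → T (insert x S y) → y ≡ x ⊎ T (S y)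
insert⁻ x S y y∈ with y ≟ x
... | yes y≡x = inj₁ y≡x
... | no _    = inj₂ y∈

insert-∉ : ∀ {n} {x y : Fin n} (S : VSet n) → x ≢ y → ¬ T (S y) → ¬ T (insert x S y)
insert-∉ {x = x} {y} S x≢y y∉S y∈ with insert⁻ x S y y∈
... | inj₁ y≡x = x≢y (sym y≡x)
... | inj₂ y∈S = y∉S y∈S

∣∣≤suc : ∀ {n} {S S′ : VSet n} x → (∀ y → T (S′ y) → y ≡ x ⊎ T (S y)) → ∣ S′ ∣ ≤ suc ∣ S ∣
∣∣≤suc {S = S} {S′} fzero S′⊆xS =
  +-mono-≤ (bit≤1 (S′ fzero)) (≤-trans (∣∣-mono tail⊆) (m≤n+m _ (bit (S fzero))))
  where
  tail⊆ : S′ ∘ fsuc ⊆ S ∘ fsuc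
  tail⊆ y y∈ with S′⊆xS (fsuc y) y∈
  ... | inj₂ y∈S = y∈S
∣∣≤suc {S = S} {S′} (fsuc x) S′⊆xS =
  ≤-trans (+-mono-≤ (bit-mono head⊆) (∣∣≤suc x tail⊆)) (≤-reflexive (+-suc _ _))
  where
  head⊆ : T (S′ fzero) → T (S fzero)
  head⊆ 0∈ with S′⊆xS fzero 0∈
  ... | inj₂ 0∈S = 0∈S
  tail⊆ : ∀ y → T (S′ (fsuc y)) → y ≡ x ⊎ T (S (fsuc y))
  tail⊆ y y∈ with S′⊆xS (fsuc y) y∈
  ... | inj₁ y≡x = inj₁ (suc-injective y≡x)
  ... | inj₂ y∈S = inj₂ y∈S

∣∣-mono-<₂ : ∀ {n} {S S′ : VSet n} {x y} → S ⊆ S′ → x ≢ y →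
  ¬ T (S x) → ¬ T (S y) → T (S′ x) → T (S′ y) → 2 + ∣ S ∣ ≤ ∣ S′ ∣
∣∣-mono-<₂ {S = S} {S′} {x} {y} S⊆S′ x≢y x∉S y∉S x∈S′ y∈S′ =
  ≤-trans (s≤s (∣∣-mono-< (insert-there x) x∉S (insert-here x S)))
          (∣∣-mono-< insert-x-S⊆S′ (insert-∉ S x≢y y∉S) y∈S′)
  where
  insert-x-S⊆S′ : insert x S ⊆ S′
  insert-x-S⊆S′ z z∈ with insert⁻ x S z z∈
  ... | inj₁ refl = x∈S′
  ... | inj₂ z∈S  = S⊆S′ z z∈S

length+∣∣≤n : ∀ {n} {S : VSet n} {xs : List (Fin n)} → Unique xs → All (λ x → ¬ T (S x)) xs →
  length xs + ∣ S ∣ ≤ n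
length+∣∣≤n {S = S} {[]}     []                 []           = ∣S∣≤n S
length+∣∣≤n {S = S} {x ∷ xs} (x≢xs ∷ xs-unique) (x∉S ∷ xs∉S) = begin
  suc (length xs + ∣ S ∣)          ≡⟨ +-suc _ _ ⟨
  length xs + suc ∣ S ∣            ≤⟨ +-monoʳ-≤ _ (∣∣-mono-< (insert-there x) x∉S (insert-here x S)) ⟩
  length xs + ∣ insert x S ∣       ≤⟨ length+∣∣≤n xs-unique xs∉insert ⟩
  _                                ∎
  where
  open ≤-Reasoning
  xs∉insert : All (λ y → ¬ T (insert x S y)) xs
  xs∉insert = All.zipWith (uncurry (insert-∉ S)) (x≢xs , xs∉S)

∣∣≡0 : ∀ {n} {S : VSet n} → (∀ x → ¬ T (S x)) → ∣ S ∣ ≡ 0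
∣∣≡0 {n} S-empty =
  n≤0⇒n≡0 (≤-trans (∣∣-mono (λ x x∈S → ⊥-elim (S-empty x x∈S))) (≤-reflexive (∣∅∣≡0 {n})))

∃-outside : ∀ {n} (S : VSet n) (xs : List (Fin n)) → ∣ S ∣ + length xs < n →
  ∃ λ t → ¬ T (S t) × All (t ≢_) xs
∃-outside S []       bound with ∃-nonmember S (≤-trans (s≤s (≤-reflexive (sym (+-identityʳ _)))) bound)
... | t , t∉S = t , t∉S , []
∃-outside S (x ∷ xs) bound
  with ∃-outside (insert x S) xs (≤-trans (s≤s (+-monoˡ-≤ _ (∣∣≤suc x (insert⁻ x S))))
                                         (≤-trans (≤-reflexive (cong suc (sym (+-suc _ _)))) bound))
... | t , t∉insert , t≢xs =
      t , t∉insert ∘ insert-there x {S} t , (λ { refl → t∉insert (insert-here t S) }) ∷ t≢xs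

∃-distinct-from : ∀ {n} (xs : List (Fin n)) → length xs < n → ∃ λ t → All (t ≢_) xs
∃-distinct-from {n} xs len<n
  with ∃-outside ∅ xs (subst (λ k → k + length xs < n) (sym (∣∅∣≡0 {n})) len<n)
... | t , _ , t≢xs = t , t≢xs

foldr-∈ : ∀ {A : Set} {_∙_ : A → A → A} → Selective _≡_ _∙_ →
  ∀ x xs → foldr _∙_ x xs ∈ x ∷ xs
foldr-∈ {_∙_ = _∙_} sel x xs =
  foldr-preservesᵇ (λ {a} {b} → closed a b) (here refl) (All.tabulate there)
  where
  closed : ∀ a b → a ∈ x ∷ xs → b ∈ x ∷ xs → (a ∙ b) ∈ x ∷ xs
  closed a b a∈ b∈ with sel a b
  ... | inj₁ a∙b≡a = subst (_∈ x ∷ xs) (sym a∙b≡a) a∈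
  ... | inj₂ a∙b≡b = subst (_∈ x ∷ xs) (sym a∙b≡b) b∈

foldr-⊓-≤ : ∀ {x xs y} → y ∈ x ∷ xs → foldr _⊓_ x xs ≤ y
foldr-⊓-≤ {x} {xs} y∈ =
  foldr-preservesᵒ (λ a b → [ m≤n⇒m⊓o≤n b , m≤n⇒o⊓m≤n a ]′) x xs (start y∈)
  where
  start : ∀ {y} → y ∈ x ∷ xs → x ≤ y ⊎ Any (_≤ y) xs
  start (here refl)  = inj₁ ≤-refl
  start (there y∈xs) = inj₂ (Any.map (λ { refl → ≤-refl }) y∈xs)

-- One move, from m targets down to u ≤ m − d, after which y moves remain.
potential-step : ∀ c d e {y u m} → 3 + c ≤ e + 2 * d → 3 * y ≤ c + 2 * u → d + u ≤ m →
  3 * suc y ≤ e + 2 * m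
potential-step c d e {y} {u} {m} c≤ y≤ d+u≤m = begin
  3 * suc y              ≡⟨ *-suc 3 y ⟩
  3 + 3 * y              ≤⟨ +-monoʳ-≤ 3 y≤ ⟩
  3 + (c + 2 * u)        ≡⟨ regroup₁ c u ⟩
  (3 + c) + 2 * u        ≤⟨ +-monoˡ-≤ (2 * u) c≤ ⟩
  (e + 2 * d) + 2 * u    ≡⟨ regroup₂ e d u ⟩
  e + 2 * (d + u)        ≤⟨ +-monoʳ-≤ e (*-monoʳ-≤ 2 d+u≤m) ⟩
  e + 2 * m              ∎
  where
  open ≤-Reasoning
  regroup₁ : ∀ c u → 3 + (c + 2 * u) ≡ (3 + c) + 2 * u
  regroup₁ = solve-∀
  regroup₂ : ∀ e d u → (e + 2 * d) + 2 * u ≡ e + 2 * (d + u)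
  regroup₂ = solve-∀

m*n≤1+o∧m∤1+o⇒m*n≤o : ∀ {m n o} → m * n ≤ suc o → ¬ m ∣ suc o → m * n ≤ o
m*n≤1+o∧m∤1+o⇒m*n≤o {m} {n} m*n≤1+o m∤1+o =
  ≤-pred (≤∧≢⇒< m*n≤1+o (λ m*n≡1+o → m∤1+o (subst (m ∣_) m*n≡1+o (m∣m*n n))))

T-not⁺ : ∀ {b} → ¬ T b → T (not b)
T-not⁺ {false} _  = tt
T-not⁺ {true}  ¬b = ¬b tt

T-not⁻ : ∀ {b} → T (not b) → ¬ T b
T-not⁻ {false} _ ()

target-shape⁺ : ∀ d s h → ¬ T d → T s ⊎ T h → T ((not d ∧ h) ∨ (s ∧ not d ∧ not h))
target-shape⁺ true  _     _     ¬d _        = ⊥-elim (¬d tt)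
target-shape⁺ false _     true  _  _        = tt
target-shape⁺ false true  false _  _        = tt
target-shape⁺ false false false _  (inj₁ ())
target-shape⁺ false false false _  (inj₂ ())

target-shape⁻ : ∀ d s h → T ((not d ∧ h) ∨ (s ∧ not d ∧ not h)) → ¬ T d × (T s ⊎ T h)
target-shape⁻ false _     true  _ = (λ ()) , inj₂ tt
target-shape⁻ false true  false _ = (λ ()) , inj₁ tt
target-shape⁻ false false false ()
target-shape⁻ true  true  _     ()
target-shape⁻ true  false _     ()

any-allFin⁺ : ∀ {n} (f : Fin n → Bool) {x} → T (f x) → T (any f (allFin n))
any-allFin⁺ f {x} fx = any⁺ f (lose {P = T ∘ f} (∈-allFin x) fx)

any-allFin⁻ : ∀ {n} (f : Fin n → Bool) → T (any f (allFin n)) → ∃ λ x → T (f x)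
any-allFin⁻ f fx = satisfied (any⁻ f (allFin _) fx)

Another : ∀ {n} → (Fin n → Set) → Fin n → Set
Another P b = ∃ λ y → P y × y ≢ b

another? : ∀ {n} {P : Fin n → Set} → Decidable P → ∀ b → Dec (Another P b)
another? P? b = any? (λ y → P? y ×-dec ¬? (y ≟ b))

¬another⇒≡ : ∀ {n} {P : Fin n → Set} {b y} → ¬ Another P b → P y → y ≡ b
¬another⇒≡ {y = y} ¬another Py = decidable-stable (y ≟ _) (λ y≢b → ¬another (y , Py , y≢b))

module _ {n : ℕ} (G : Graph n) where
  open Game G

  Adj-sym : ∀ {u v} → Adj G u v → Adj G v u
  Adj-sym {u} {v} = subst T (Graph.sym G u v)

  Adj⇒≢ : ∀ {u v} → Adj G u v → u ≢ v
  Adj⇒≢ {u} u~u refl = subst T (irrefl G u) u~u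

  adj? : ∀ u → Decidable (Adj G u)
  adj? u v = T? (adj G u v)

  Dominated : VSet n → Fin n → Set
  Dominated S x = T (inN S x)

  hasUndominatedNeighbour : VSet n → Fin n → Bool
  hasUndominatedNeighbour S u = any (λ w → adj G u w ∧ not (inN S w)) (allFin n)

  -- legal S v unfolds to "v ∉ S and v has a neighbour in target S".
  target : VSet n → VSet n
  target S u = inBigComp S u ∨ isolatedSelected S u

  UndominatedNeighbour : VSet n → Fin n → Fin n → Set
  UndominatedNeighbour S u w = Adj G u w × ¬ Dominated S w

  undominatedNeighbour? : ∀ S u → Decidable (UndominatedNeighbour S u)
  undominatedNeighbour? S u w = adj? u w ×-dec ¬? (T? (inN S w))

  dominated⁺ : ∀ {S w x} → T (S w) → Adj G w x → Dominated S x
  dominated⁺ {S} {w} {x} w∈S w~x =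
    any-allFin⁺ (λ w → S w ∧ adj G w x) (Equivalence.from T-∧ (w∈S , w~x))

  dominated⁻ : ∀ {S x} → Dominated S x → ∃ λ w → T (S w) × Adj G w x
  dominated⁻ {S} {x} x-dom = map₂ (Equivalence.to T-∧) (any-allFin⁻ (λ w → S w ∧ adj G w x) x-dom)

  ¬dominated-∅ : ∀ {x} → ¬ Dominated ∅ x
  ¬dominated-∅ {x} x-dom with dominated⁻ {∅} {x} x-dom
  ... | _ , () , _

  dominated-mono : ∀ {S v x} → Dominated S x → Dominated (insert v S) x
  dominated-mono {S} {v} x-dom with dominated⁻ {S} x-dom
  ... | w , w∈S , w~x = dominated⁺ (insert-there v {S} w w∈S) w~x

  dominated-by : ∀ {S v x} → Adj G v x → Dominated (insert v S) x
  dominated-by {S} {v} = dominated⁺ (insert-here v S)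

  dominated-insert⁻ : ∀ {S v x} → Dominated (insert v S) x → Adj G v x ⊎ Dominated S x
  dominated-insert⁻ {S} {v} x-dom with dominated⁻ x-dom
  ... | w , w∈ , w~x with insert⁻ v S w w∈
  ...   | inj₁ refl = inj₁ w~x
  ...   | inj₂ w∈S  = inj₂ (dominated⁺ w∈S w~x)

  ¬selected-next-to-undominated : ∀ {S w x} → Adj G w x → ¬ Dominated S x → ¬ T (S w)
  ¬selected-next-to-undominated w~x x-undom w∈S = x-undom (dominated⁺ w∈S w~x)

  undominatedNeighbour⁺ : ∀ {S u w} → UndominatedNeighbour S u w → T (hasUndominatedNeighbour S u)
  undominatedNeighbour⁺ {S} {u} (u~w , w-undom) =
    any-allFin⁺ (λ w → adj G u w ∧ not (inN S w)) (Equivalence.from T-∧ (u~w , T-not⁺ w-undom))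

  undominatedNeighbour⁻ : ∀ {S u} → T (hasUndominatedNeighbour S u) → ∃ (UndominatedNeighbour S u)
  undominatedNeighbour⁻ {S} {u} has with any-allFin⁻ (λ w → adj G u w ∧ not (inN S w)) has
  ... | w , p with Equivalence.to T-∧ p
  ...   | u~w , w-undom = w , u~w , T-not⁻ w-undom

  target⁺ : ∀ {S u} → ¬ Dominated S u → T (S u) ⊎ T (hasUndominatedNeighbour S u) → T (target S u)
  target⁺ {S} {u} = target-shape⁺ (inN S u) (S u) (hasUndominatedNeighbour S u)

  target⁻ : ∀ {S u} → T (target S u) → ¬ Dominated S u × (T (S u) ⊎ T (hasUndominatedNeighbour S u))
  target⁻ {S} {u} = target-shape⁻ (inN S u) (S u) (hasUndominatedNeighbour S u)

  edge-target : ∀ {S u w} → Adj G u w → ¬ Dominated S u → ¬ Dominated S w → T (target S u)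
  edge-target u~w u-undom w-undom = target⁺ u-undom (inj₂ (undominatedNeighbour⁺ (u~w , w-undom)))

  ¬target-dominated : ∀ {S x} → Dominated S x → ¬ T (target S x)
  ¬target-dominated x-dom x-target = proj₁ (target⁻ x-target) x-dom

  ¬target-next-to : ∀ {S v x} → Adj G v x → ¬ T (target (insert v S) x)
  ¬target-next-to {S} v~x = ¬target-dominated (dominated-by {S} v~x)

  ¬target-isolated : ∀ {S x} → ¬ T (S x) → (∀ {y} → Adj G x y → Dominated S y) → ¬ T (target S x)
  ¬target-isolated x∉S nbrs-dom x-target with proj₂ (target⁻ x-target)
  ... | inj₁ x∈S = x∉S x∈S
  ... | inj₂ has with undominatedNeighbour⁻ has
  ...   | y , x~y , y-undom = y-undom (nbrs-dom x~y)

  legal⁺ : ∀ {S v u} → ¬ T (S v) → Adj G v u → T (target S u) → T (legal S v)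
  legal⁺ {S} {v} v∉S v~u u-target =
    Equivalence.from T-∧
      (T-not⁺ v∉S , any-allFin⁺ (λ u → adj G v u ∧ target S u) (Equivalence.from T-∧ (v~u , u-target)))

  legal⁻ : ∀ {S v} → T (legal S v) → ¬ T (S v) × ∃ λ u → Adj G v u × T (target S u)
  legal⁻ {S} {v} v-legal with Equivalence.to T-∧ v-legal
  ... | v∉S , has with any-allFin⁻ (λ u → adj G v u ∧ target S u) has
  ...   | u , p = T-not⁻ v∉S , u , Equivalence.to T-∧ p

  legal-∅ : ∀ {v a} → Adj G v a → T (legal ∅ v)
  legal-∅ {v} {a} v~a =
    legal⁺ (λ ()) v~a (edge-target {∅} (Adj-sym v~a) (¬dominated-∅ {a}) (¬dominated-∅ {v}))

  targets-shrink : ∀ {S w} → T (legal S w) → target (insert w S) ⊆ target S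
  targets-shrink {S} {w} w-legal u u-target′ with target⁻ {insert w S} u-target′
  ... | u-undom′ , inj₂ has′ with undominatedNeighbour⁻ {insert w S} has′
  ...   | y , u~y , y-undom′ = target⁺ (u-undom′ ∘ dominated-mono)
                                   (inj₂ (undominatedNeighbour⁺ (u~y , y-undom′ ∘ dominated-mono)))
  targets-shrink {S} {w} w-legal u u-target′ | u-undom′ , inj₁ u∈ with insert⁻ w S u u∈
  ...   | inj₂ u∈S = target⁺ (u-undom′ ∘ dominated-mono) (inj₁ u∈S)
  ...   | inj₁ refl with legal⁻ w-legal
  ...     | _ , t , w~t , t-target = target⁺ (u-undom′ ∘ dominated-mono)
                                         (inj₂ (undominatedNeighbour⁺ (w~t , proj₁ (target⁻ t-target))))

  ∣target∣-decreases : ∀ {S w} → T (legal S w) → ∣ target (insert w S) ∣ < ∣ target S ∣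
  ∣target∣-decreases {S} {w} w-legal with legal⁻ w-legal
  ... | _ , u , w~u , u-target =
        ∣∣-mono-< (targets-shrink w-legal) (¬target-next-to {S} w~u) u-target

  DoubleGain : VSet n → Set
  DoubleGain S = ∃ λ w → T (legal S w) × 2 + ∣ target (insert w S) ∣ ≤ ∣ target S ∣

  removes-two : ∀ {S w x y} → T (legal S w) → x ≢ y → T (target S x) → T (target S y) →
    ¬ T (target (insert w S) x) → ¬ T (target (insert w S) y) → DoubleGain S
  removes-two w-legal x≢y x-target y-target x-gone y-gone =
    _ , w-legal , ∣∣-mono-<₂ (targets-shrink w-legal) x≢y x-gone y-gone x-target y-target

  centre-gain : ∀ {S w x y} → Adj G w x → Adj G w y → x ≢ y → T (target S x) → T (target S y) →
    DoubleGain S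
  centre-gain {S} w~x w~y x≢y x-target y-target =
    removes-two (legal⁺ (¬selected-next-to-undominated w~x (proj₁ (target⁻ x-target))) w~x x-target)
      x≢y x-target y-target (¬target-next-to {S} w~x) (¬target-next-to {S} w~y)

  -- Since u is w's only undominated neighbour, playing z dominates u and leaves w isolated.
  isolating-gain : ∀ {S z u w} → Adj G z u → Adj G u w → z ≢ w → ¬ Dominated S u → ¬ Dominated S w →
    ¬ Another (UndominatedNeighbour S w) u → DoubleGain S
  isolating-gain {S} {z} {u} {w} z~u u~w z≢w u-undom w-undom w-only-u =
    removes-two z-legal (Adj⇒≢ u~w) u-target (edge-target (Adj-sym u~w) w-undom u-undom)
      (¬target-next-to {S} z~u) w-isolated
    where
    u-target : T (target S u)
    u-target = edge-target u~w u-undom w-undom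
    z-legal : T (legal S z)
    z-legal = legal⁺ (¬selected-next-to-undominated z~u u-undom) z~u u-target
    w-isolated : ¬ T (target (insert z S) w)
    w-isolated w-target with proj₂ (target⁻ {insert z S} w-target)
    ... | inj₁ w∈ with insert⁻ z S w w∈
    ...   | inj₁ w≡z = z≢w (sym w≡z)
    ...   | inj₂ w∈S = ¬selected-next-to-undominated (Adj-sym u~w) u-undom w∈S
    w-isolated w-target | inj₂ has with undominatedNeighbour⁻ {insert z S} has
    ...   | y , w~y , y-undom′ with ¬another⇒≡ w-only-u (w~y , y-undom′ ∘ dominated-mono)
    ...     | refl = y-undom′ (dominated-by {S} z~u)

  legal⇒∈moves : ∀ {S v} → T (legal S v) → v ∈ moves S
  legal⇒∈moves {S} {v} = ∈-filter⁺ (λ v → T? (legal S v)) (∈-allFin v)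

  ∈moves⇒legal : ∀ {S v} → v ∈ moves S → T (legal S v)
  ∈moves⇒legal {S} v∈ = proj₂ (∈-filter⁻ (λ v → T? (legal S v)) {xs = allFin n} v∈)

  valueAfter : ℕ → Player → VSet n → Fin n → ℕ
  valueAfter k p S w = value k (other p) (insert w S)

  opt-∈ : ∀ p x xs → opt p x xs ∈ x ∷ xs
  opt-∈ dominator = foldr-∈ ⊓-sel
  opt-∈ staller   = foldr-∈ ⊔-sel

  value-suc : ∀ k p S →
    value (suc k) p S ≡ 0 ⊎ ∃ λ w → T (legal S w) × value (suc k) p S ≡ suc (valueAfter k p S w)
  value-suc k p S with moves S in moves≡
  ... | []     = inj₁ refl
  ... | v ∷ vs with ∈-map⁻ (valueAfter k p S) (opt-∈ p (valueAfter k p S v) (map (valueAfter k p S) vs))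
  ...   | w , w∈ , opt≡ = inj₂ (w , ∈moves⇒legal (subst (w ∈_) (sym moves≡) w∈) , cong suc opt≡)

  dominator-value-≤ : ∀ k {S w} → T (legal S w) →
    value (suc k) dominator S ≤ suc (valueAfter k dominator S w)
  dominator-value-≤ k {S} {w} w-legal with moves S in moves≡
  ... | []     = z≤n
  ... | v ∷ vs =
        s≤s (foldr-⊓-≤ (∈-map⁺ (valueAfter k dominator S) (subst (w ∈_) moves≡ (legal⇒∈moves w-legal))))

  value-finished : ∀ k p S → ∣ target S ∣ ≡ 0 → value k p S ≡ 0
  value-finished zero    p S _        = refl
  value-finished (suc k) p S no-target with value-suc k p S
  ... | inj₁ value≡0         = value≡0
  ... | inj₂ (w , w-legal , _)
    with subst (∣ target (insert w S) ∣ <_) no-target (∣target∣-decreases w-legal)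
  ...   | ()

  Degree≥3 : Fin n → Set
  Degree≥3 v = ∃ λ a → ∃ λ b → ∃ λ c →
    Adj G v a × Adj G v b × Adj G v c × a ≢ b × a ≢ c × b ≢ c

  degree≥3? : Decidable Degree≥3
  degree≥3? v = any? λ a → any? λ b → any? λ c →
    adj? v a ×-dec adj? v b ×-dec adj? v c ×-dec ¬? (a ≟ b) ×-dec ¬? (a ≟ c) ×-dec ¬? (b ≟ c)

  reply-finishes : ∀ k {S u} → T (legal S u) → ∣ target (insert u S) ∣ ≡ 0 →
    value k dominator S ≤ 1
  reply-finishes zero    _       _    = z≤n
  reply-finishes (suc k) u-legal done =
    ≤-trans (dominator-value-≤ k u-legal) (s≤s (≤-reflexive (value-finished k staller _ done)))

  module _ (diam : DiamAtMost2 G) (n≥3 : 3 ≤ n) where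

    sole-neighbour-adjacent : ∀ {u w t} → ¬ Another (Adj G u) w → t ≢ u → t ≢ w → Adj G w t
    sole-neighbour-adjacent u-only-w t≢u t≢w with diam _ _ (t≢u ∘ sym)
    ... | inj₁ u~t             = ⊥-elim (t≢w (¬another⇒≡ u-only-w u~t))
    ... | inj₂ (c , u~c , c~t) = subst (λ c → Adj G c _) (¬another⇒≡ u-only-w u~c) c~t

    edge-gain : ∀ {S u w} → Adj G u w → ¬ Dominated S u → ¬ Dominated S w → DoubleGain S
    edge-gain {S} {u} {w} u~w u-undom w-undom with another? (undominatedNeighbour? S w) u
    ... | yes (y , (w~y , y-undom) , y≢u) =
          centre-gain (Adj-sym u~w) w~y (y≢u ∘ sym) (edge-target u~w u-undom w-undom)
            (edge-target (Adj-sym w~y) y-undom w-undom)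
    ... | no w-only-u with another? (undominatedNeighbour? S u) w
    ...   | yes (y , (u~y , y-undom) , y≢w) =
            centre-gain u~w u~y (y≢w ∘ sym) (edge-target (Adj-sym u~w) w-undom u-undom)
              (edge-target (Adj-sym u~y) y-undom u-undom)
    ...   | no u-only-w with another? (adj? u) w
    ...     | yes (z , u~z , z≢w) = isolating-gain (Adj-sym u~z) u~w z≢w u-undom w-undom w-only-u
    ...     | no u-sole-w with ∃-distinct-from (u ∷ w ∷ []) n≥3
    ...       | t , t≢u ∷ t≢w ∷ [] =
                isolating-gain (Adj-sym (sole-neighbour-adjacent u-sole-w t≢u t≢w)) (Adj-sym u~w) t≢u
                  w-undom u-undom u-only-w

    dominator-double-gain : ∀ {S} → 2 ≤ ∣ target S ∣ → DoubleGain S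
    dominator-double-gain {S} 2≤∣target∣ with ∃-two-members (target S) 2≤∣target∣
    ... | x , y , x≢y , x-target , y-target with target⁻ {S} x-target | target⁻ {S} y-target
    ...   | x-undom , inj₂ x-has | _ with undominatedNeighbour⁻ {S} x-has
    ...     | w , x~w , w-undom = edge-gain x~w x-undom w-undom
    dominator-double-gain {S} _ | x , y , x≢y , x-target , y-target | _ | y-undom , inj₂ y-has
      with undominatedNeighbour⁻ {S} y-has
    ...     | w , y~w , w-undom = edge-gain y~w y-undom w-undom
    dominator-double-gain {S} _ | x , y , x≢y , x-target , y-target | _ , inj₁ x∈S | y-undom , inj₁ _
      with diam x y x≢y
    ...     | inj₁ x~y             = ⊥-elim (y-undom (dominated⁺ x∈S x~y))
    ...     | inj₂ (c , x~c , c~y) = centre-gain (Adj-sym x~c) c~y x≢y x-target y-target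

    dominator-value-bound : ∀ k S → 3 * value k dominator S ≤ 1 + 2 * ∣ target S ∣
    staller-value-bound   : ∀ k S → 3 * value k staller S ≤ 2 + 2 * ∣ target S ∣

    dominator-value-bound zero    S = z≤n
    dominator-value-bound (suc k) S with value-suc k dominator S
    ... | inj₁ value≡0 rewrite value≡0 = z≤n
    ... | inj₂ (w₀ , w₀-legal , _) with 2 ≤? ∣ target S ∣
    ...   | yes 2≤∣target∣ with dominator-double-gain 2≤∣target∣
    ...     | w , w-legal , gain =
              ≤-trans (*-monoʳ-≤ 3 (dominator-value-≤ k w-legal))
                      (potential-step 2 2 1 ≤-refl (staller-value-bound k (insert w S)) gain)
    dominator-value-bound (suc k) S | inj₂ (w₀ , w₀-legal , _) | no 2≰∣target∣ =
      ≤-trans (*-monoʳ-≤ 3 (dominator-value-≤ k w₀-legal))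
              (potential-step 0 1 1 ≤-refl staller-done (∣target∣-decreases w₀-legal))
      where
      no-target-left : ∣ target (insert w₀ S) ∣ ≡ 0
      no-target-left =
        n≤0⇒n≡0 (≤-pred (≤-trans (∣target∣-decreases w₀-legal) (≤-pred (≰⇒> 2≰∣target∣))))
      staller-done : 3 * value k staller (insert w₀ S) ≤ 0 + 2 * ∣ target (insert w₀ S) ∣
      staller-done = ≤-trans (≤-reflexive (cong (3 *_) (value-finished k staller _ no-target-left))) z≤n

    staller-value-bound zero    S = z≤n
    staller-value-bound (suc k) S with value-suc k staller S
    ... | inj₁ value≡0 rewrite value≡0 = z≤n
    ... | inj₂ (w , w-legal , value≡) rewrite value≡ =
          potential-step 1 1 2 ≤-refl (dominator-value-bound k (insert w S)) (∣target∣-decreases w-legal)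

    staller-starts : ∀ k → 3 * value (suc k) staller ∅ ≤ 2 * n
    staller-starts k with value-suc k staller ∅
    ... | inj₁ value≡0 rewrite value≡0 = z≤n
    ... | inj₂ (w , w-legal , value≡) rewrite value≡ with legal⁻ w-legal
    ...   | _ , u , w~u , _ with another? (adj? w) u
    ...     | yes (z , w~z , z≢u) =
              potential-step 1 2 0 ≤-refl (dominator-value-bound k (insert w ∅))
                (length+∣∣≤n ((z≢u ∘ sym ∷ []) ∷ [] ∷ [])
                  (¬target-next-to {∅} w~u ∷ ¬target-next-to {∅} w~z ∷ []))
    ...     | no w-sole-u =
              potential-step 3 3 0 ≤-refl (*-monoʳ-≤ 3 (reply-finishes k u-legal all-dominated)) n≥3
      where
      u-legal : T (legal (insert w ∅) u)
      u-legal =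
        legal⁺ (insert-∉ ∅ (Adj⇒≢ w~u) (λ ())) (Adj-sym w~u) (target⁺ w-undom (inj₁ (insert-here w ∅)))
        where
        w-undom : ¬ Dominated (insert w ∅) w
        w-undom w-dom with dominated-insert⁻ {∅} w-dom
        ... | inj₁ w~w  = Adj⇒≢ w~w refl
        ... | inj₂ w-dom∅ = ¬dominated-∅ {w} w-dom∅
      all-dominated : ∣ target (insert u (insert w ∅)) ∣ ≡ 0
      all-dominated = ∣∣≡0 λ x → ¬target-dominated (dominated x)
        where
        dominated : ∀ x → Dominated (insert u (insert w ∅)) x
        dominated x with x ≟ u | x ≟ w
        ... | yes refl | _        = dominated-mono (dominated-by {∅} w~u)
        ... | no _     | yes refl = dominated-by (Adj-sym w~u)
        ... | no x≢u   | no x≢w   = dominated-by (sole-neighbour-adjacent w-sole-u x≢w x≢u)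

    dominator-starts-parity : ∀ k → ¬ 3 ∣ 1 + 2 * n → 3 * value k dominator ∅ ≤ 2 * n
    dominator-starts-parity k 3∤ =
      m*n≤1+o∧m∤1+o⇒m*n≤o {n = value k dominator ∅}
        (≤-trans (dominator-value-bound k ∅) (+-monoʳ-≤ 1 (*-monoʳ-≤ 2 (∣S∣≤n (target ∅))))) 3∤

    vertex₀ : Fin n
    vertex₀ = fromℕ< {0} (≤-trans (s≤s z≤n) n≥3)

    some-neighbour : ∀ {u t} → Adj G u t ⊎ (∃ λ c → Adj G u c × Adj G c t) → ∃ (Adj G u)
    some-neighbour (inj₁ u~t)           = _ , u~t
    some-neighbour (inj₂ (c , u~c , _)) = c , u~c

    two-neighbours : ∃ λ v → ∃ λ a → ∃ λ b → Adj G v a × Adj G v b × a ≢ b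
    two-neighbours with ∃-distinct-from (vertex₀ ∷ []) (≤-trans (s≤s (s≤s z≤n)) n≥3)
    ... | t , t≢p ∷ [] with some-neighbour (diam vertex₀ t (t≢p ∘ sym))
    ...   | q , p~q with another? (adj? vertex₀) q
    ...     | yes (r , p~r , r≢q) = vertex₀ , q , r , p~q , p~r , r≢q ∘ sym
    ...     | no p-sole-q with ∃-distinct-from (vertex₀ ∷ q ∷ []) n≥3
    ...       | s , s≢p ∷ s≢q ∷ [] =
                q , vertex₀ , s , Adj-sym p~q , sole-neighbour-adjacent p-sole-q s≢p s≢q , s≢p ∘ sym

    module _ (n≥4 : 4 ≤ n) (n≢5 : n ≢ 5) where

      GoodFirstMove : Set
      GoodFirstMove = ∃ λ v → T (legal ∅ v) × 3 + ∣ target (insert v ∅) ∣ ≤ n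

      first-move-resolving : ∀ {v a b c} → Adj G v a → a ≢ b → a ≢ c → b ≢ c →
        All (λ x → ¬ T (target (insert v ∅) x)) (a ∷ b ∷ c ∷ []) → GoodFirstMove
      first-move-resolving v~a a≢b a≢c b≢c resolved =
        _ , legal-∅ v~a , length+∣∣≤n ((a≢b ∷ a≢c ∷ []) ∷ (b≢c ∷ []) ∷ [] ∷ []) resolved

      module MaxDegreeTwo (Δ≤2 : ∀ v → ¬ Degree≥3 v)
                          {v a b} (v~a : Adj G v a) (v~b : Adj G v b) (a≢b : a ≢ b) where

        crowded : ∀ {s p q} → Adj G v s → Adj G s p → Adj G s q → p ≢ v → q ≢ v → p ≢ q → ⊥
        crowded v~s s~p s~q p≢v q≢v p≢q =
          Δ≤2 _ (v , _ , _ , Adj-sym v~s , s~p , s~q , p≢v ∘ sym , q≢v ∘ sym , p≢q)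

        Outside : Fin n → Set
        Outside t = All (t ≢_) (v ∷ a ∷ b ∷ [])

        outside-adjacent : ∀ {t} → Outside t → Adj G a t ⊎ Adj G b t
        outside-adjacent {t} (t≢v ∷ t≢a ∷ t≢b ∷ []) with diam v t (t≢v ∘ sym)
        ... | inj₁ v~t = ⊥-elim (Δ≤2 v (a , b , t , v~a , v~b , v~t , a≢b , t≢a ∘ sym , t≢b ∘ sym))
        ... | inj₂ (c , v~c , c~t) with c ≟ a | c ≟ b
        ...   | yes refl | _        = inj₁ c~t
        ...   | no _     | yes refl = inj₂ c~t
        ...   | no c≢a   | no c≢b   = ⊥-elim (Δ≤2 v (a , b , c , v~a , v~b , v~c , a≢b , c≢a ∘ sym , c≢b ∘ sym))

        at-most-two-outside : ∀ {w x y} → Outside w → Outside x → Outside y → w ≢ x → w ≢ y → x ≢ y → ⊥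
        at-most-two-outside w-out@(w≢v ∷ _) x-out@(x≢v ∷ _) y-out@(y≢v ∷ _) w≢x w≢y x≢y
          with outside-adjacent w-out | outside-adjacent x-out | outside-adjacent y-out
        ... | inj₁ a~w | inj₁ a~x | _        = crowded v~a a~w a~x w≢v x≢v w≢x
        ... | inj₁ a~w | inj₂ b~x | inj₁ a~y = crowded v~a a~w a~y w≢v y≢v w≢y
        ... | inj₁ _   | inj₂ b~x | inj₂ b~y = crowded v~b b~x b~y x≢v y≢v x≢y
        ... | inj₂ _   | inj₁ a~x | inj₁ a~y = crowded v~a a~x a~y x≢v y≢v x≢y
        ... | inj₂ b~w | inj₁ _   | inj₂ b~y = crowded v~b b~w b~y w≢v y≢v w≢y
        ... | inj₂ b~w | inj₂ b~x | _        = crowded v~b b~w b~x w≢v x≢v w≢x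

        6≤n : ∀ {w x} → Outside w → Outside x → w ≢ x → 6 ≤ n
        6≤n {w} {x} (w≢v ∷ w≢a ∷ w≢b ∷ []) (x≢v ∷ x≢a ∷ x≢b ∷ []) w≢x =
          ≤∧≢⇒< (m+n≤o⇒m≤o 5 (length+∣∣≤n {S = ∅} distinct (All.universal (λ _ ()) _))) (n≢5 ∘ sym)
          where
          distinct : Unique (v ∷ a ∷ b ∷ w ∷ x ∷ [])
          distinct = (Adj⇒≢ v~a ∷ Adj⇒≢ v~b ∷ w≢v ∘ sym ∷ x≢v ∘ sym ∷ [])
                   ∷ (a≢b ∷ w≢a ∘ sym ∷ x≢a ∘ sym ∷ [])
                   ∷ (w≢b ∘ sym ∷ x≢b ∘ sym ∷ [])
                   ∷ (w≢x ∷ [])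
                   ∷ []
                   ∷ []

        at-most-one-outside : ∀ {w x} → Outside w → Outside x → w ≢ x → ⊥
        at-most-one-outside w-out x-out w≢x
          with ∃-distinct-from (v ∷ a ∷ b ∷ _ ∷ _ ∷ []) (6≤n w-out x-out w≢x)
        ... | y , y≢v ∷ y≢a ∷ y≢b ∷ y≢w ∷ y≢x ∷ [] =
              at-most-two-outside w-out x-out (y≢v ∷ y≢a ∷ y≢b ∷ []) w≢x (y≢w ∘ sym) (y≢x ∘ sym)

      -- Here G is C₄ (C₅ being excluded by n ≢ 5) and w is the vertex opposite v.
      first-move-Δ≤2 : (∀ v → ¬ Degree≥3 v) → GoodFirstMove
      first-move-Δ≤2 Δ≤2 with two-neighbours
      ... | v , a , b , v~a , v~b , a≢b with ∃-distinct-from (v ∷ a ∷ b ∷ []) n≥4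
      ...   | w , w-out@(w≢v ∷ w≢a ∷ w≢b ∷ []) with another? (λ y → adj? w y ×-dec ¬? (y ≟ a)) b
      ...     | no w-nbrs-in-ab =
                first-move-resolving v~a a≢b (w≢a ∘ sym) (w≢b ∘ sym)
                  (¬target-next-to {∅} v~a ∷ ¬target-next-to {∅} v~b ∷ w-isolated ∷ [])
        where
        nbr-dominated : ∀ {y} → Adj G w y → Dominated (insert v ∅) y
        nbr-dominated {y} w~y with y ≟ a
        ... | yes refl = dominated-by v~a
        ... | no y≢a with ¬another⇒≡ w-nbrs-in-ab (w~y , y≢a)
        ...   | refl = dominated-by v~b
        w-isolated : ¬ T (target (insert v ∅) w)
        w-isolated = ¬target-isolated (λ w∈ → [ w≢v , (λ ()) ]′ (insert⁻ v ∅ w w∈)) nbr-dominated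
      ...     | yes (x , (w~x , x≢a) , x≢b) =
                ⊥-elim (at-most-one-outside w-out (x≢v ∷ x≢a ∷ x≢b ∷ []) (Adj⇒≢ w~x))
        where
        open MaxDegreeTwo Δ≤2 v~a v~b a≢b
        x≢v : x ≢ v
        x≢v refl = Δ≤2 v (a , b , w , v~a , v~b , Adj-sym w~x , a≢b , w≢a ∘ sym , w≢b ∘ sym)

      first-move : GoodFirstMove
      first-move with any? degree≥3?
      ... | yes (v , a , b , c , v~a , v~b , v~c , a≢b , a≢c , b≢c) =
            first-move-resolving v~a a≢b a≢c b≢c
              (¬target-next-to {∅} v~a ∷ ¬target-next-to {∅} v~b
                ∷ ¬target-next-to {∅} v~c ∷ [])
      ... | no ¬degree≥3 = first-move-Δ≤2 (λ v v-degree≥3 → ¬degree≥3 (v , v-degree≥3))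

      dominator-starts : ∀ k → 3 * value (suc k) dominator ∅ ≤ 2 * n
      dominator-starts k with first-move
      ... | v , v-legal , gain =
            ≤-trans (*-monoʳ-≤ 3 (dominator-value-≤ k v-legal))
                    (potential-step 2 3 0 (n≤1+n 5) (staller-value-bound k (insert v ∅)) gain)

dominator-first : ∀ n (G : Graph n) → DiamAtMost2 G → 3 ≤ n → 3 * γitg G ≤ 2 * n
dominator-first 1 _ _ (s≤s ())
dominator-first 2 _ _ (s≤s (s≤s ()))
dominator-first 3 G diam n≥3 = dominator-starts-parity G diam n≥3 3 (from-no (3 ∣? 7))
dominator-first 4 G diam n≥3 = dominator-starts G diam n≥3 ≤-refl (λ ()) 3
dominator-first 5 G diam n≥3 = dominator-starts-parity G diam n≥3 5 (from-no (3 ∣? 11))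
dominator-first (suc (suc (suc (suc (suc (suc m)))))) G diam n≥3 =
  dominator-starts G diam n≥3 (s≤s (s≤s (s≤s (s≤s z≤n)))) (λ ()) (5 + m)

staller-first : ∀ n (G : Graph n) → DiamAtMost2 G → 3 ≤ n → 3 * γitg′ G ≤ 2 * n
staller-first (suc k) G diam n≥3 = staller-starts G diam n≥3 k

theorem3p6 : (n : ℕ) (G : Graph n) → 3 ≤ n → Connected G → DiamAtMost2 G →
    (3 * γitg G ≤ 2 * n) × (3 * γitg′ G ≤ 2 * n)
theorem3p6 n G n≥3 _ diam = dominator-first n G diam n≥3 , staller-first n G diam n≥3
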